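{- If $S$ is admissible, then \[\#P_B(S,n)=\#\widehat{P}_B(S,n)+\#\widehat{P}_B(S\cup\{1\},n).\]
   Context: $B_n$ is the set of signed permutations $\pi=\pi_1\cdots\pi_n$: words with each $\pi_i\in\{ -n,\dots,-1,1,\dots,n\}$ and $\{|\pi_1|,\dots,|\pi_n|\}=\{1,\dots,n\}$. Without padding, an index $i\in\{2,\dots,n-1\}$ is a peak of $\pi$ if $\pi_{i-1}<\pi_i>\pi_{i+1}$, and $P_B(S,n)$ is the set of $\pi\in B_n$ with this peak set equal to $S$. With $\pi_0=0$ prepended, an index $i\in\{1,\dots,n-1\}$ is a peak if $\pi_{i-1}<\pi_i>\pi_{i+1}$, and $\widehat{P}_B(S,n)$ is the set of $\pi\in B_n$ with this peak set equal to $S$. $S$ is $n$-admissible if $\#P_B(S,n)\ne0$; admissible means the identity is asserted for every $n$ for which $S$ is $n$-admissible. -}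

module Defs where

open import Data.Bool using (Bool; true; false; _∧_; not; if_then_else_)
open import Data.Nat using (ℕ; zero; suc; _∸_; _≤ᵇ_) renaming (_≡ᵇ_ to _==ℕ_)
open import Data.Integer using (ℤ; +_; -_; ∣_∣; _<?_)
open import Data.List using (List; []; _∷_; map; concatMap; filter; length; applyUpTo)
open import Data.Bool.ListAction using (all; any)
open import Data.List.Base using (lookup)
open import Relation.Nullary.Decidable using (does)
open import Relation.Binary.PropositionalEquality using (_≡_)
open import Data.Bool.Properties using () renaming (_≟_ to _≟B_)

-- Words are lists of integers, positions are 1-indexed.
-- at w i = π_i for 1 ≤ i ≤ length w, and at w 0 = 0 (the padding π_0 = 0).
at : List ℤ → ℕ → ℤ
at []      _             = + 0
at (x ∷ w) zero          = + 0
at (x ∷ w) (suc zero)    = x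
at (x ∷ w) (suc (suc i)) = at w (suc i)

range : ℕ → ℕ → List ℕ
range a b = applyUpTo (λ k → a Data.Nat.+ k) (suc b ∸ a)

_∈ᵇ_ : ℕ → List ℕ → Bool
k ∈ᵇ S = any (λ j → k ==ℕ j) S

localMax : List ℤ → ℕ → Bool
localMax w i = does (at w (i ∸ 1) <? at w i) ∧ does (at w (suc i) <? at w i)

-- peak set without padding: indices i ∈ {2,…,n-1}
peakSet : List ℤ → List ℕ
peakSet w = filter (λ i → localMax w i ≟B true) (range 2 (length w ∸ 1))

-- peak set with π_0 = 0 prepended: indices i ∈ {1,…,n-1}
hatPeakSet : List ℤ → List ℕ
hatPeakSet w = filter (λ i → localMax w i ≟B true) (range 1 (length w ∸ 1))

sameSet : List ℕ → List ℕ → Bool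
sameSet A B = all (λ a → a ∈ᵇ B) A ∧ all (λ b → b ∈ᵇ A) B

words : List ℤ → ℕ → List (List ℤ)
words xs zero    = [] ∷ []
words xs (suc m) = concatMap (λ x → map (x ∷_) (words xs m)) xs

isSignedPerm : ℕ → List ℤ → Bool
isSignedPerm n w = (length w ==ℕ n)
  ∧ all (λ x → ∣ x ∣ ∈ᵇ range 1 n) w
  ∧ all (λ k → any (λ x → ∣ x ∣ ==ℕ k) w) (range 1 n)

B : ℕ → List (List ℤ)
B n = filter (λ w → isSignedPerm n w ≟B true)
        (words (map (λ k → - (+ k)) (range 1 n) Data.List.++ map +_ (range 1 n)) n)

#P : List ℕ → ℕ → ℕ
#P S n = length (filter (λ w → sameSet (peakSet w) S ≟B true) (B n))

#P̂ : List ℕ → ℕ → ℕ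
#P̂ S n = length (filter (λ w → sameSet (hatPeakSet w) S ≟B true) (B n))

-- Without padding, index 1 is never a peak; with π₀ = 0 prepended, the hatted
-- peak set of π is its unpadded peak set, possibly together with 1. So if 1 ∉ S,
-- the signed permutations with peak set S are exactly those whose hatted peak
-- set is S or S ∪ {1}, and the count splits accordingly. If 1 ∈ S, then
-- #P_B(S,n) = 0, which admissibility excludes.
module Submission where

open import Defs
open import Data.Bool using (Bool; true; false; _∧_; _∨_; T)
open import Data.Bool.Properties using (∧-zeroʳ; ∨-conicalˡ; ∨-conicalʳ) renaming (_≟_ to _≟B_)
open import Data.Bool.ListAction using (all)
open import Data.Empty using (⊥-elim)
open import Data.Integer using (ℤ)
open import Data.List using (List; []; _∷_; filter; length; applyUpTo)
open import Data.Nat using (ℕ; zero; suc; _+_; _∸_) renaming (_≡ᵇ_ to _==ℕ_)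
open import Data.Nat.Properties using (+-identityʳ; ≡ᵇ⇒≡; +-commutativeSemigroup)
open import Algebra.Properties.CommutativeSemigroup +-commutativeSemigroup using () renaming (interchange to +-interchange)
open import Data.Sum using (_⊎_; inj₁; inj₂)
open import Relation.Binary.PropositionalEquality using (_≡_; _≢_; refl; sym; trans; cong; cong₂; subst)
open import Relation.Nullary.Decidable using (does)
open import Relation.Unary using (Pred; Decidable)

toℕ : Bool → ℕ
toℕ true  = 1
toℕ false = 0

-- #P S n and #P̂ S n unfold definitionally to instances of count.
count : ∀ {A : Set} → (A → Bool) → List A → ℕ
count f xs = length (filter (λ x → f x ≟B true) xs)

count-∷ : ∀ {A : Set} (f : A → Bool) (x : A) (xs : List A) →
  count f (x ∷ xs) ≡ toℕ (f x) + count f xs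
count-∷ f x xs with f x
... | true  = refl
... | false = refl

count-+ : ∀ {A : Set} (f g h : A → Bool) → (∀ x → toℕ (f x) ≡ toℕ (g x) + toℕ (h x)) →
  ∀ xs → count f xs ≡ count g xs + count h xs
count-+ f g h split [] = refl
count-+ f g h split (x ∷ xs)
  rewrite count-∷ f x xs | count-∷ g x xs | count-∷ h x xs | split x | count-+ f g h split xs
  = +-interchange (toℕ (g x)) (toℕ (h x)) (count g xs) (count h xs)

count-const-false : ∀ {A : Set} (f : A → Bool) → (∀ x → f x ≡ false) → ∀ xs → count f xs ≡ 0
count-const-false f never [] = refl
count-const-false f never (x ∷ xs) rewrite count-∷ f x xs | never x = count-const-false f never xs

∉-filter : ∀ {p} {P : Pred ℕ p} (P? : Decidable P) (k : ℕ) (xs : List ℕ) →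
  (k ∈ᵇ xs) ≡ false → (k ∈ᵇ filter P? xs) ≡ false
∉-filter P? k [] _ = refl
∉-filter P? k (x ∷ xs) k∉ with does (P? x)
... | false = ∉-filter P? k xs (∨-conicalʳ (k ==ℕ x) _ k∉)
... | true  = cong₂ _∨_ (∨-conicalˡ (k ==ℕ x) _ k∉) (∉-filter P? k xs (∨-conicalʳ (k ==ℕ x) _ k∉))

∉-applyUpTo : (k : ℕ) (f : ℕ → ℕ) → (∀ i → (k ==ℕ f i) ≡ false) →
  ∀ m → (k ∈ᵇ applyUpTo f m) ≡ false
∉-applyUpTo k f k≢f zero = refl
∉-applyUpTo k f k≢f (suc m) rewrite k≢f 0 = ∉-applyUpTo k (λ i → f (suc i)) (λ i → k≢f (suc i)) m

1∉peakSet : (w : List ℤ) → (1 ∈ᵇ peakSet w) ≡ false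
1∉peakSet w = ∉-filter _ 1 (range 2 (length w ∸ 1)) (∉-applyUpTo 1 (2 +_) (λ _ → refl) (length w ∸ 1 ∸ 1))

all-false : (g : ℕ → Bool) (k : ℕ) (xs : List ℕ) → (k ∈ᵇ xs) ≡ true → g k ≡ false →
  all g xs ≡ false
all-false g k (x ∷ xs) k∈ gk with k ==ℕ x in k==x
... | true rewrite sym (≡ᵇ⇒≡ k x (subst T (sym k==x) _)) | gk = refl
... | false = trans (cong (g x ∧_) (all-false g k xs k∈ gk)) (∧-zeroʳ (g x))

sameSet-∉ˡ : (k : ℕ) (P S : List ℕ) → (k ∈ᵇ P) ≡ true → (k ∈ᵇ S) ≡ false →
  sameSet P S ≡ false
sameSet-∉ˡ k P S k∈P k∉S rewrite all-false (_∈ᵇ S) k P k∈P k∉S = refl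

sameSet-∉ʳ : (k : ℕ) (P S : List ℕ) → (k ∈ᵇ S) ≡ true → (k ∈ᵇ P) ≡ false →
  sameSet P S ≡ false
sameSet-∉ʳ k P S k∈S k∉P rewrite all-false (_∈ᵇ P) k S k∈S k∉P = ∧-zeroʳ _

all-∈ᵇ-1∷ : (S P : List ℕ) → (1 ∈ᵇ P) ≡ false → all (_∈ᵇ (1 ∷ S)) P ≡ all (_∈ᵇ S) P
all-∈ᵇ-1∷ S [] _ = refl
all-∈ᵇ-1∷ S (zero ∷ P) 1∉P = cong (zero ∈ᵇ S ∧_) (all-∈ᵇ-1∷ S P 1∉P)
all-∈ᵇ-1∷ S (suc zero ∷ P) ()
all-∈ᵇ-1∷ S (suc (suc a) ∷ P) 1∉P = cong (suc (suc a) ∈ᵇ S ∧_) (all-∈ᵇ-1∷ S P 1∉P)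

sameSet-1∷ : (P S : List ℕ) → (1 ∈ᵇ P) ≡ false → (1 ∈ᵇ S) ≡ false →
  sameSet (1 ∷ P) (1 ∷ S) ≡ sameSet P S
sameSet-1∷ P S 1∉P 1∉S rewrite all-∈ᵇ-1∷ S P 1∉P | all-∈ᵇ-1∷ P S 1∉S = refl

sameSet-split : (P S H : List ℕ) → (1 ∈ᵇ P) ≡ false → (1 ∈ᵇ S) ≡ false →
  H ≡ P ⊎ H ≡ 1 ∷ P →
  toℕ (sameSet P S) ≡ toℕ (sameSet H S) + toℕ (sameSet H (1 ∷ S))
sameSet-split P S _ 1∉P 1∉S (inj₁ refl)
  rewrite sameSet-∉ʳ 1 P (1 ∷ S) refl 1∉P = sym (+-identityʳ _)
sameSet-split P S _ 1∉P 1∉S (inj₂ refl)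
  rewrite sameSet-∉ˡ 1 (1 ∷ P) S refl 1∉S | sameSet-1∷ P S 1∉P 1∉S = refl

hatPeakSet-cases : (w : List ℤ) → hatPeakSet w ≡ peakSet w ⊎ hatPeakSet w ≡ 1 ∷ peakSet w
hatPeakSet-cases [] = inj₁ refl
hatPeakSet-cases (x ∷ []) = inj₁ refl
hatPeakSet-cases w@(x ∷ y ∷ v) with does (localMax w 1 ≟B true)
... | true  = inj₂ refl
... | false = inj₁ refl

#P≡0 : (S : List ℕ) (n : ℕ) → (1 ∈ᵇ S) ≡ true → #P S n ≡ 0
#P≡0 S n 1∈S = count-const-false _ (λ w → sameSet-∉ʳ 1 (peakSet w) S 1∈S (1∉peakSet w)) (B n)

proposition3p5 : (S : List ℕ) (n : ℕ) → #P S n ≢ 0 →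
    #P S n ≡ #P̂ S n + #P̂ (1 ∷ S) n
proposition3p5 S n #P≢0 with 1 ∈ᵇ S in 1∈ᵇS
... | true  = ⊥-elim (#P≢0 (#P≡0 S n 1∈ᵇS))
... | false = count-+ _ _ _ split (B n)
  where
  split : ∀ w → toℕ (sameSet (peakSet w) S)
              ≡ toℕ (sameSet (hatPeakSet w) S) + toℕ (sameSet (hatPeakSet w) (1 ∷ S))
  split w = sameSet-split (peakSet w) S (hatPeakSet w) (1∉peakSet w) 1∈ᵇS (hatPeakSet-cases w)
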